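{- (Provably in $\mathrm{EA}$.) Let $t$ be a tree ordinal, $\beta<\varepsilon_0$ an ordinal and $n,m$ natural numbers. If $o(t)\le\beta$, $n+N(o(t))-N\beta\le m-2$, $n+Cr(t)<m-2$, and $H_\beta(m)$ is defined, then $H_t(n)$ is defined and $H_t(n)\le H_\beta(m)$.
   Context: Tree ordinals: the set $\mathcal{T}$ of formal terms given by $0\in\mathcal{T}$ and, if $t_1,\dots,t_n\in\mathcal{T}$ ($n\ge1$), the formal (unnormalized) sum $\omega^{t_1}+\dots+\omega^{t_n}\in\mathcal{T}$. Sum of terms is concatenation of summands ($0$ neutral); $1:=\omega^0$, $t+1$ appends the summand $\omega^0$; $t\cdot 0=0$, $t\cdot(x+1)=t\cdot x+t$. A nonzero term is a successor if its last summand is $\omega^0$ and a limit otherwise. Fundamental sequences on terms: $0[x]=0$, $(t+1)[x]=t$, $(t+\omega^{s+1})[x]=t+\omega^s\cdot x$, $(t+\omega^\lambda)[x]=t+\omega^{\lambda[x]}$ for limit terms $\lambda$ (here $t$ may be $0$). Value: $o(0)=0$, $o(\omega^{t_1}+\dots+\omega^{t_n})=\omega^{o(t_1)}+\dots+\omega^{o(t_n)}$ (ordinal arithmetic); $t<s$ abbreviates $o(t)<o(s)$. Norm: on ordinals $<\varepsilon_0$, $N0=0$ and $N(\omega^\alpha+\beta)=1+N\alpha+N\beta$ where $\beta<\omega^{\alpha+1}$; on terms $N0=0$ and $N(\omega^{t_1}+\dots+\omega^{t_n})=\sum_i(1+Nt_i)$. Correction function: $Cr(0)=0$ and $Cr(\omega^{t_1}+\dots+\omega^{t_n})=\sum\{N(\omega^{t_i}):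 t_i<t_j\text{ for some }j>i\}+\max\{Cr(t_i):i\le n\}$. Fundamental sequences for ordinals $<\varepsilon_0$ (Cantor normal form): $0[x]=0$, $(\gamma+1)[x]=\gamma$, $(\gamma+\omega^{\delta+1})[x]=\gamma+\omega^\delta\cdot x$, $(\gamma+\omega^\lambda)[x]=\gamma+\omega^{\lambda[x]}$ for limit $\lambda$. Hardy functions (for terms, and likewise for ordinals $<\varepsilon_0$): $H_0(x)=x$, $H_{t+1}(x)=H_t(x+1)$, $H_t(x)=H_{t[x]}(x)$ for limit $t$; "defined" means the (finite) evaluation sequence exists. Subtraction is integer subtraction. -}

module Defs where

open import Data.Nat using (ℕ; zero; suc; _+_; _⊔_)
open import Data.Bool using (Bool; true; false; not; if_then_else_)
open import Data.List using (List; []; _∷_; _++_; replicate; filterᵇ)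
open import Data.Product using (Σ; _×_)
open import Relation.Binary.PropositionalEquality using (_≡_; _≢_)

-- Tree ordinals.  node [] is the term 0, and
-- node (t₁ ∷ … ∷ tₙ ∷ [])  (n ≥ 1) is the formal sum ω^t₁ + … + ω^tₙ.

data Tree : Set where
  node : List Tree → Tree

𝟘 : Tree
𝟘 = node []

-- Comparison of Cantor normal forms (lexicographic on the exponent lists).
-- Ordinals < ε₀ are represented by trees in Cantor normal form (CNF below).

data Ord3 : Set where
  lt eq gt : Ord3

mutual
  cmp : Tree → Tree → Ord3
  cmp (node as) (node bs) = cmpL as bs

  cmpL : List Tree → List Tree → Ord3
  cmpL []       []       = eq
  cmpL []       (_ ∷ _)  = lt
  cmpL (_ ∷ _)  []       = gt
  cmpL (a ∷ as) (b ∷ bs) with cmp a b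
  ... | lt = lt
  ... | gt = gt
  ... | eq = cmpL as bs

_<ᵇ_ : Tree → Tree → Bool
a <ᵇ b with cmp a b
... | lt = true
... | _  = false

mutual
  data CNF : Tree → Set where
    cnf : ∀ {ts} → CNFList ts → CNF (node ts)

  data CNFList : List Tree → Set where
    []  : CNFList []
    sing : ∀ {t} → CNF t → CNFList (t ∷ [])
    _∷_ : ∀ {t u us} → CNF t → cmp t u ≢ lt → CNFList (u ∷ us) → CNFList (t ∷ u ∷ us)

_<ᴼ_ : Tree → Tree → Set
a <ᴼ b = cmp a b ≡ lt

_≤ᴼ_ : Tree → Tree → Set
a ≤ᴼ b = cmp a b ≢ gt

-- Ordinal addition of Cantor normal forms.

_⊕_ : Tree → Tree → Tree
node as ⊕ node []       = node as
node as ⊕ node (b ∷ bs) = node (filterᵇ (λ a → not (a <ᵇ b)) as ++ b ∷ bs)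

-- value o(t) (as a Cantor normal form):
-- o(ω^t₁ + … + ω^tₙ) = ω^o(t₁) + … + ω^o(tₙ) (ordinal arithmetic)
mutual
  o : Tree → Tree
  o (node ts) = sumω 𝟘 (oL ts)

  oL : List Tree → List Tree
  oL []       = []
  oL (t ∷ ts) = o t ∷ oL ts

  sumω : Tree → List Tree → Tree
  sumω acc []       = acc
  sumω acc (e ∷ es) = sumω (acc ⊕ node (e ∷ [])) es

_<ᵀᵇ_ : Tree → Tree → Bool
t <ᵀᵇ s = o t <ᵇ o s

-- Norm.  On terms: N0 = 0, N(ω^t₁+…+ω^tₙ) = Σ (1 + N tᵢ).
-- On a Cantor normal form this is the same recursion as
-- N(ω^α + β) = 1 + Nα + Nβ.

mutual
  N : Tree → ℕ
  N (node ts) = NL ts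

  NL : List Tree → ℕ
  NL []       = 0
  NL (t ∷ ts) = suc (N t) + NL ts

anyLater : Tree → List Tree → Bool
anyLater t []       = false
anyLater t (u ∷ us) = if t <ᵀᵇ u then true else anyLater t us

crSum : List Tree → ℕ
crSum []       = 0
crSum (t ∷ ts) = (if anyLater t ts then N (node (t ∷ [])) else 0) + crSum ts

mutual
  Cr : Tree → ℕ
  Cr (node ts) = crSum ts + crMax ts

  crMax : List Tree → ℕ
  crMax []       = 0
  crMax (t ∷ ts) = Cr t ⊔ crMax ts

lastIsOne : List Tree → Bool
lastIsOne []               = false
lastIsOne (node [] ∷ [])   = true
lastIsOne (node (_ ∷ _) ∷ []) = false
lastIsOne (_ ∷ u ∷ us)     = lastIsOne (u ∷ us)

data Kind : Set where
  isZero isSucc isLimit : Kind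

kind : Tree → Kind
kind (node [])       = isZero
kind (node (t ∷ ts)) = if lastIsOne (t ∷ ts) then isSucc else isLimit

-- fsL ts x : summands of (ω^t₁+…+ω^tₙ)[x]
-- fsLast s x : what replaces the last summand ω^s
--   (t+1)[x] = t ;  (t+ω^(s+1))[x] = t + ω^s·x ;  (t+ω^λ)[x] = t + ω^(λ[x])
-- (note (s+1)[x] = s, so in both non-trivial cases the new exponent is s'[x])
mutual
  fsL : List Tree → ℕ → List Tree
  fsL []           x = []
  fsL (t ∷ [])     x = fsLast t x
  fsL (t ∷ u ∷ us) x = t ∷ fsL (u ∷ us) x

  fsLast : Tree → ℕ → List Tree
  fsLast (node [])       x = []
  fsLast (node (s ∷ ss)) x =
    if lastIsOne (s ∷ ss)
    then replicate x (node (fsL (s ∷ ss) x))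
    else node (fsL (s ∷ ss) x) ∷ []

_[_] : Tree → ℕ → Tree
node ts [ x ] = node (fsL ts x)

-- Hardy functions as an evaluation relation: Hardy t x y means that
-- H_t(x) is defined (finite evaluation sequence) and equals y.

data Hardy : Tree → ℕ → ℕ → Set where
  H-zero  : ∀ {x} → Hardy 𝟘 x x
  H-succ  : ∀ {t x y} → kind t ≡ isSucc  → Hardy (t [ x ]) (suc x) y → Hardy t x y
  H-limit : ∀ {t x y} → kind t ≡ isLimit → Hardy (t [ x ]) x y → Hardy t x y

Defined : Tree → ℕ → Set
Defined t x = Σ ℕ (Hardy t x)

{-# OPTIONS --safe #-}
module Submission where

-- Follow the evaluation of H_β(m) step by step, carrying the three premises
-- along; at each step either o t < β or o t = β.
-- If o t < β, t stays and β moves to β[m]. For a successor β, o t ≤ β[m] at once,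
-- and N β drops by one while m grows by one. For a limit β, N(β[m]) ≥ N β + m − 2,
-- so the norm premise gives N(o t) ≤ N(β[m]); by the Bachmann property no ordinal
-- of that norm lies strictly between β[m] and β, hence o t ≤ β[m].
-- If o t = β, then t is a successor or limit together with β and both step: for
-- successors o(t[n]) = β[m]; for limits o(t[n]) < β and N(o(t[n])) ≤ N(β[m]) as long
-- as n + Cr t ≤ m (Cr t pays for the summands of t lost when t is normalised), so
-- the Bachmann property again gives o(t[n]) ≤ β[m]. As Cr(t[n]) ≤ Cr t, the
-- correction premise is inherited.

module Domination where

  open import Defs
  import Data.Integer as ℤ
  import Data.Integer.Properties as ℤ
  import Data.Integer.Tactic.RingSolver as ℤ
  open import Data.Bool using (Bool; true; false; not; if_then_else_)
  open import Data.Empty using (⊥-elim)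
  open import Data.Product using (Σ; _×_; _,_)
  open import Data.Sum using (_⊎_; inj₁; inj₂)
  open import Data.List using (List; []; _∷_; _++_; replicate; filterᵇ)
  open import Data.Nat using (ℕ; zero; suc; _+_; _*_; _≤_; _<_; _⊔_; z≤n; s≤s)
  open import Data.Nat.Properties
  open import Data.Nat.Tactic.RingSolver using (solve-∀)
  open import Algebra.Properties.CommutativeSemigroup +-commutativeSemigroup using (x∙yz≈y∙xz; xy∙z≈xz∙y)
  open import Relation.Binary.PropositionalEquality hiding ([_])
  open import Data.List.Relation.Unary.All as All using (All; []; _∷_)
  open import Data.List.Relation.Unary.All.Properties using (++⁺; filter⁺; replicate⁺)
  open import Data.List.Properties using (++-identityʳ; ++-conicalʳ; filter-++)
  open import Function using (_∘_)
  open import Relation.Nullary using (¬_; Dec; yes; no)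
  open import Relation.Nullary.Decidable using (T?)

  infix 30 ω^_
  ω^_ : Tree → Tree
  ω^ x = node (x ∷ [])

  summands : Tree → List Tree
  summands (node ts) = ts

  infix 4 _<ᴸ_
  _<ᴸ_ : List Tree → List Tree → Set
  as <ᴸ bs = cmpL as bs ≡ lt

  flip : Ord3 → Ord3
  flip lt = gt
  flip eq = eq
  flip gt = lt

  mutual
    cmp-refl : ∀ a → cmp a a ≡ eq
    cmp-refl (node as) = cmpL-refl as

    cmpL-refl : ∀ as → cmpL as as ≡ eq
    cmpL-refl []       = refl
    cmpL-refl (a ∷ as) rewrite cmp-refl a = cmpL-refl as

  mutual
    cmp≡eq⇒≡ : ∀ a b → cmp a b ≡ eq → a ≡ b
    cmp≡eq⇒≡ (node as) (node bs) e = cong node (cmpL≡eq⇒≡ as bs e)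

    cmpL≡eq⇒≡ : ∀ as bs → cmpL as bs ≡ eq → as ≡ bs
    cmpL≡eq⇒≡ []       []       e = refl
    cmpL≡eq⇒≡ (a ∷ as) (b ∷ bs) e with cmp a b in e′
    ... | eq = cong₂ _∷_ (cmp≡eq⇒≡ a b e′) (cmpL≡eq⇒≡ as bs e)

  mutual
    cmp-flip : ∀ a b → cmp b a ≡ flip (cmp a b)
    cmp-flip (node as) (node bs) = cmpL-flip as bs

    cmpL-flip : ∀ as bs → cmpL bs as ≡ flip (cmpL as bs)
    cmpL-flip []       []       = refl
    cmpL-flip []       (_ ∷ _)  = refl
    cmpL-flip (_ ∷ _)  []       = refl
    cmpL-flip (a ∷ as) (b ∷ bs) rewrite cmp-flip a b with cmp a b
    ... | lt = refl
    ... | eq = cmpL-flip as bs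
    ... | gt = refl

  <ᴼ-flip : ∀ a b → a <ᴼ b → cmp b a ≡ gt
  <ᴼ-flip a b e = trans (cmp-flip a b) (cong flip e)

  >ᴼ-flip : ∀ a b → cmp a b ≡ gt → b <ᴼ a
  >ᴼ-flip a b e = trans (cmp-flip a b) (cong flip e)

  >ᴸ-flip : ∀ as bs → cmpL as bs ≡ gt → bs <ᴸ as
  >ᴸ-flip as bs e = trans (cmpL-flip as bs) (cong flip e)

  ≮ᴼ⇒≥ᴼ : ∀ a b → ¬ a <ᴼ b → b ≤ᴼ a
  ≮ᴼ⇒≥ᴼ a b a≮b b>a = a≮b (>ᴼ-flip b a b>a)

  ≤ᴼ⇒≯ᴼ : ∀ a b → a ≤ᴼ b → ¬ b <ᴼ a
  ≤ᴼ⇒≯ᴼ a b a≤b b<a = a≤b (<ᴼ-flip b a b<a)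

  <ᴼ-irrefl : ∀ a → ¬ a <ᴼ a
  <ᴼ-irrefl a a<a with () ← trans (sym a<a) (cmp-refl a)

  ≡⇒≤ᴼ : ∀ {a b} → a ≡ b → a ≤ᴼ b
  ≡⇒≤ᴼ {a} refl a>a with () ← trans (sym a>a) (cmp-refl a)

  ¬<ᴸ[] : ∀ as → ¬ as <ᴸ []
  ¬<ᴸ[] []      ()
  ¬<ᴸ[] (_ ∷ _) ()

  ¬<ᴼ𝟘 : ∀ a → ¬ a <ᴼ 𝟘
  ¬<ᴼ𝟘 (node as) = ¬<ᴸ[] as

  ≤ᴼ𝟘⇒≡𝟘 : ∀ a → a ≤ᴼ 𝟘 → a ≡ 𝟘
  ≤ᴼ𝟘⇒≡𝟘 (node [])      _   = refl
  ≤ᴼ𝟘⇒≡𝟘 (node (_ ∷ _)) a≤𝟘 = ⊥-elim (a≤𝟘 refl)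

  mutual
    <ᴼ-trans : ∀ a b c → a <ᴼ b → b <ᴼ c → a <ᴼ c
    <ᴼ-trans (node as) (node bs) (node cs) = <ᴸ-trans as bs cs

    <ᴸ-trans : ∀ as bs cs → as <ᴸ bs → bs <ᴸ cs → as <ᴸ cs
    <ᴸ-trans []       bs       []       _ bs<[] = ⊥-elim (¬<ᴸ[] bs bs<[])
    <ᴸ-trans []       bs       (_ ∷ _)  _ _     = refl
    <ᴸ-trans (a ∷ as) (b ∷ bs) (c ∷ cs) p q with cmp a b in ab | cmp b c in bc
    ... | lt | lt rewrite <ᴼ-trans a b c ab bc = refl
    ... | lt | eq rewrite sym (cmp≡eq⇒≡ b c bc) | ab = refl
    ... | eq | lt rewrite cmp≡eq⇒≡ a b ab | bc = refl
    ... | eq | eq rewrite cmp≡eq⇒≡ a b ab | cmp≡eq⇒≡ b c bc | cmp-refl c = <ᴸ-trans as bs cs p q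

  ≤ᴼ-<ᴼ-trans : ∀ a b c → a ≤ᴼ b → b <ᴼ c → a <ᴼ c
  ≤ᴼ-<ᴼ-trans a b c a≤b b<c with cmp a b in ab
  ... | lt = <ᴼ-trans a b c ab b<c
  ... | eq rewrite cmp≡eq⇒≡ a b ab = b<c
  ... | gt = ⊥-elim (a≤b refl)

  <ᴼ-≤ᴼ-trans : ∀ a b c → a <ᴼ b → b ≤ᴼ c → a <ᴼ c
  <ᴼ-≤ᴼ-trans a b c a<b b≤c with cmp b c in bc
  ... | lt = <ᴼ-trans a b c a<b bc
  ... | eq rewrite sym (cmp≡eq⇒≡ b c bc) = a<b
  ... | gt = ⊥-elim (b≤c refl)

  ≤ᴼ-trans : ∀ a b c → a ≤ᴼ b → b ≤ᴼ c → a ≤ᴼ c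
  ≤ᴼ-trans a b c a≤b b≤c a>c with cmp a b in ab
  ... | lt with () ← trans (sym a>c) (<ᴼ-≤ᴼ-trans a b c ab b≤c)
  ... | eq rewrite cmp≡eq⇒≡ a b ab = b≤c a>c
  ... | gt = a≤b refl

  ≤ᴼ⇒<ᴼ⊎≡ : ∀ a b → a ≤ᴼ b → a <ᴼ b ⊎ a ≡ b
  ≤ᴼ⇒<ᴼ⊎≡ a b a≤b with cmp a b in ab
  ... | lt = inj₁ refl
  ... | eq = inj₂ (cmp≡eq⇒≡ a b ab)
  ... | gt = ⊥-elim (a≤b refl)

  <ᴸ-∷-inv : ∀ a as b bs → (a ∷ as) <ᴸ (b ∷ bs) → a <ᴼ b ⊎ (a ≡ b × as <ᴸ bs)
  <ᴸ-∷-inv a as b bs a∷as<b∷bs with cmp a b in ab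
  ... | lt = inj₁ refl
  ... | eq = inj₂ (cmp≡eq⇒≡ a b ab , a∷as<b∷bs)

  _<ᴼ?_ : ∀ a b → Dec (a <ᴼ b)
  a <ᴼ? b with cmp a b
  ... | lt = yes refl
  ... | eq = no λ ()
  ... | gt = no λ ()

  <ᵇ⇒<ᴼ : ∀ a b → (a <ᵇ b) ≡ true → a <ᴼ b
  <ᵇ⇒<ᴼ a b a<b with cmp a b
  ... | lt = refl

  <ᴼ⇒<ᵇ : ∀ a b → a <ᴼ b → (a <ᵇ b) ≡ true
  <ᴼ⇒<ᵇ a b a<b rewrite a<b = refl

  -- Normal forms and ordinal addition

  CNF-summands : ∀ {T} → CNF T → CNFList (summands T)
  CNF-summands (cnf c) = c

  CNF-head : ∀ {a as} → CNFList (a ∷ as) → CNF a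
  CNF-head (sing c)     = c
  CNF-head (_∷_ c _ _)  = c

  CNF-tail : ∀ {a as} → CNFList (a ∷ as) → CNFList as
  CNF-tail (sing _)     = []
  CNF-tail (_∷_ _ _ cl) = cl

  CNF-descending : ∀ {a as} → CNFList (a ∷ as) → All (_≤ᴼ a) as
  CNF-descending (sing _) = []
  CNF-descending {a} (_∷_ {u = u} _ a≮u cl) =
    ≮ᴼ⇒≥ᴼ a u a≮u ∷ All.map (λ {d} d≤u → ≤ᴼ-trans d u a d≤u (≮ᴼ⇒≥ᴼ a u a≮u)) (CNF-descending cl)

  CNF-∷ : ∀ {a as} → CNF a → All (_≤ᴼ a) as → CNFList as → CNFList (a ∷ as)
  CNF-∷ ca []                [] = sing ca
  CNF-∷ {a} {r ∷ _} ca (r≤a ∷ _) cl = _∷_ ca (≤ᴼ⇒≯ᴼ r a r≤a) cl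

  CNF-tail-<ᴼ : ∀ a b {as} → CNFList (a ∷ as) → a <ᴼ b → All (_<ᴼ b) as
  CNF-tail-<ᴼ a b cas a<b = All.map (λ {d} d≤a → ≤ᴼ-<ᴼ-trans d a b d≤a a<b) (CNF-descending cas)

  notBelow : Tree → Tree → Bool
  notBelow b a = not (a <ᵇ b)

  filter-below : ∀ a b xs → a <ᴼ b → filterᵇ (notBelow b) (a ∷ xs) ≡ filterᵇ (notBelow b) xs
  filter-below a b xs a<b rewrite a<b = refl

  filter-notBelow : ∀ a b xs → ¬ a <ᴼ b → filterᵇ (notBelow b) (a ∷ xs) ≡ a ∷ filterᵇ (notBelow b) xs
  filter-notBelow a b xs a≮b with cmp a b
  ... | lt = ⊥-elim (a≮b refl)
  ... | eq = refl
  ... | gt = refl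

  filter-all-below : ∀ b xs → All (_<ᴼ b) xs → filterᵇ (notBelow b) xs ≡ []
  filter-all-below b []       []           = refl
  filter-all-below b (x ∷ xs) (x<b ∷ xs<b) =
    trans (filter-below x b xs x<b) (filter-all-below b xs xs<b)

  filterᵇ-∷-cong : ∀ (p : Tree → Bool) a {ys zs} →
                   filterᵇ p ys ≡ filterᵇ p zs → filterᵇ p (a ∷ ys) ≡ filterᵇ p (a ∷ zs)
  filterᵇ-∷-cong p a ys≡zs with p a
  ... | true  = cong (a ∷_) ys≡zs
  ... | false = ys≡zs

  filter-notBelow-absorb : ∀ x b as → x <ᴼ b →
                           filterᵇ (notBelow b) (filterᵇ (notBelow x) as) ≡ filterᵇ (notBelow b) as
  filter-notBelow-absorb x b []       x<b = refl
  filter-notBelow-absorb x b (a ∷ as) x<b with a <ᴼ? x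
  ... | yes a<x rewrite filter-below a x as a<x | filter-below a b as (<ᴼ-trans a x b a<x x<b) =
    filter-notBelow-absorb x b as x<b
  ... | no a≮x rewrite filter-notBelow a x as a≮x =
    filterᵇ-∷-cong (notBelow b) a (filter-notBelow-absorb x b as x<b)

  ⊕ω-absorb : ∀ A x b → x <ᴼ b → (A ⊕ ω^ x) ⊕ ω^ b ≡ A ⊕ ω^ b
  ⊕ω-absorb (node as) x b x<b = cong (λ l → node (l ++ b ∷ [])) (begin
      filterᵇ (notBelow b) (kept ++ x ∷ [])
    ≡⟨ filter-++ (T? ∘ notBelow b) kept (x ∷ []) ⟩
      filterᵇ (notBelow b) kept ++ filterᵇ (notBelow b) (x ∷ [])
    ≡⟨ cong (filterᵇ (notBelow b) kept ++_) (filter-below x b [] x<b) ⟩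
      filterᵇ (notBelow b) kept ++ []
    ≡⟨ ++-identityʳ _ ⟩
      filterᵇ (notBelow b) kept
    ≡⟨ filter-notBelow-absorb x b as x<b ⟩
      filterᵇ (notBelow b) as ∎)
    where
      open ≡-Reasoning
      kept = filterᵇ (notBelow x) as

  ⊕ω-CNFList : ∀ as x → CNFList as → CNF x → CNFList (filterᵇ (notBelow x) as ++ x ∷ [])
  ⊕ω-CNFList []       x []  cx = sing cx
  ⊕ω-CNFList (a ∷ as) x cas cx with a <ᴼ? x
  ... | yes a<x rewrite filter-below a x as a<x
                      | filter-all-below x as (CNF-tail-<ᴼ a x cas a<x) = sing cx
  ... | no a≮x rewrite filter-notBelow a x as a≮x =
    CNF-∷ (CNF-head cas)
          (++⁺ (filter⁺ (T? ∘ notBelow x) (CNF-descending cas)) (≮ᴼ⇒≥ᴼ a x a≮x ∷ []))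
          (⊕ω-CNFList as x (CNF-tail cas) cx)

  ⊕ω-CNF : ∀ A x → CNF A → CNF x → CNF (A ⊕ ω^ x)
  ⊕ω-CNF (node as) x (cnf cas) cx = cnf (⊕ω-CNFList as x cas cx)

  sumω-CNF : ∀ A xs → CNF A → All CNF xs → CNF (sumω A xs)
  sumω-CNF A []       cA []         = cA
  sumω-CNF A (x ∷ xs) cA (cx ∷ cxs) = sumω-CNF (A ⊕ ω^ x) xs (⊕ω-CNF A x cA cx) cxs

  mutual
    o-CNF : ∀ t → CNF (o t)
    o-CNF (node ts) = sumω-CNF 𝟘 (oL ts) (cnf []) (oL-CNF ts)

    oL-CNF : ∀ ts → All CNF (oL ts)
    oL-CNF []       = []
    oL-CNF (t ∷ ts) = o-CNF t ∷ oL-CNF ts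

  <ᴸ-⊕ω : ∀ as b → CNFList as → as <ᴸ filterᵇ (notBelow b) as ++ b ∷ []
  <ᴸ-⊕ω []       b _   = refl
  <ᴸ-⊕ω (a ∷ as) b cas with a <ᴼ? b
  ... | yes a<b rewrite filter-below a b as a<b
                      | filter-all-below b as (CNF-tail-<ᴼ a b cas a<b) | a<b = refl
  ... | no a≮b rewrite filter-notBelow a b as a≮b | cmp-refl a = <ᴸ-⊕ω as b (CNF-tail cas)

  <ᴼ-⊕ω : ∀ A b → CNF A → A <ᴼ (A ⊕ ω^ b)
  <ᴼ-⊕ω (node as) b (cnf cas) = <ᴸ-⊕ω as b cas

  sumω-<ᴼ-⊕ω : ∀ A xs b → CNF A → All CNF xs → All (_<ᴼ b) xs → sumω A xs <ᴼ (A ⊕ ω^ b)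
  sumω-<ᴼ-⊕ω A []       b cA []         []           = <ᴼ-⊕ω A b cA
  sumω-<ᴼ-⊕ω A (x ∷ xs) b cA (cx ∷ cxs) (x<b ∷ xs<b) =
    subst (sumω (A ⊕ ω^ x) xs <ᴼ_) (⊕ω-absorb A x b x<b)
          (sumω-<ᴼ-⊕ω (A ⊕ ω^ x) xs b (⊕ω-CNF A x cA cx) cxs xs<b)

  fsLast-constant : ∀ s ss n → All (_≡ node (fsL (s ∷ ss) n)) (fsLast (node (s ∷ ss)) n)
  fsLast-constant s ss n with lastIsOne (s ∷ ss)
  ... | true  = replicate⁺ n refl
  ... | false = refl ∷ []

  oL-constant : ∀ {y} L → All (_≡ y) L → All (_≡ o y) (oL L)
  oL-constant []      []          = []
  oL-constant (_ ∷ L) (refl ∷ ps) = refl ∷ oL-constant L ps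

  sumω-fsL-<ᴼ : ∀ s ss A n → CNF A → sumω A (oL (fsL (s ∷ ss) n)) <ᴼ sumω A (oL (s ∷ ss))
  sumω-fsL-<ᴼ (node [])       []       A n cA = <ᴼ-⊕ω A 𝟘 cA
  sumω-fsL-<ᴼ (node (s ∷ ss)) []       A n cA =
    sumω-<ᴼ-⊕ω A (oL L) _ cA (oL-CNF L)
      (All.map (λ { refl → sumω-fsL-<ᴼ s ss 𝟘 n (cnf []) }) (oL-constant L (fsLast-constant s ss n)))
    where L = fsLast (node (s ∷ ss)) n
  sumω-fsL-<ᴼ x               (u ∷ us) A n cA =
    sumω-fsL-<ᴼ u us (A ⊕ ω^ o x) n (⊕ω-CNF A (o x) cA (o-CNF x))

  o-[]-<ᴼ : ∀ s ss n → o (node (s ∷ ss) [ n ]) <ᴼ o (node (s ∷ ss))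
  o-[]-<ᴼ s ss n = sumω-fsL-<ᴼ s ss 𝟘 n (cnf [])

  last : Tree → List Tree → Tree
  last s []       = s
  last s (u ∷ us) = last u us

  lastIsOne-∷ : ∀ x u us → lastIsOne (x ∷ u ∷ us) ≡ lastIsOne (u ∷ us)
  lastIsOne-∷ (node [])      u us = refl
  lastIsOne-∷ (node (_ ∷ _)) u us = refl

  lastIsOne-last : ∀ s ss → lastIsOne (s ∷ ss) ≡ lastIsOne (last s ss ∷ [])
  lastIsOne-last s        []       = refl
  lastIsOne-last s        (u ∷ us) = trans (lastIsOne-∷ s u us) (lastIsOne-last u us)

  lastIsOne-∷ʳ : ∀ P y → lastIsOne (P ++ y ∷ []) ≡ lastIsOne (y ∷ [])
  lastIsOne-∷ʳ []          y = refl
  lastIsOne-∷ʳ (p ∷ [])    y = lastIsOne-∷ p y []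
  lastIsOne-∷ʳ (p ∷ q ∷ P) y = trans (lastIsOne-∷ p q (P ++ y ∷ [])) (lastIsOne-∷ʳ (q ∷ P) y)

  summands-sumω : ∀ A s ss → Σ (List Tree) λ P → summands (sumω A (oL (s ∷ ss))) ≡ P ++ o (last s ss) ∷ []
  summands-sumω (node as) s []       = filterᵇ (notBelow (o s)) as , refl
  summands-sumω A         s (u ∷ us) = summands-sumω (A ⊕ ω^ o s) u us

  summands-o≢[] : ∀ A s ss → summands (sumω A (oL (s ∷ ss))) ≢ []
  summands-o≢[] A s ss empty with summands-sumω A s ss
  ... | P , e with () ← ++-conicalʳ P _ (trans (sym e) empty)

  lastIsOne-o : ∀ y → lastIsOne (o y ∷ []) ≡ lastIsOne (y ∷ [])
  lastIsOne-o (node [])       = refl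
  lastIsOne-o (node (s ∷ ss)) = nonzero (o (node (s ∷ ss))) (summands-o≢[] 𝟘 s ss)
    where
      nonzero : ∀ T → summands T ≢ [] → lastIsOne (T ∷ []) ≡ false
      nonzero (node [])      ne = ⊥-elim (ne refl)
      nonzero (node (_ ∷ _)) ne = refl

  lastIsOne-sumω : ∀ A s ss → lastIsOne (summands (sumω A (oL (s ∷ ss)))) ≡ lastIsOne (s ∷ ss)
  lastIsOne-sumω A s ss with summands-sumω A s ss
  ... | P , e = begin
      lastIsOne (summands (sumω A (oL (s ∷ ss))))  ≡⟨ cong lastIsOne e ⟩
      lastIsOne (P ++ o (last s ss) ∷ [])          ≡⟨ lastIsOne-∷ʳ P _ ⟩
      lastIsOne (o (last s ss) ∷ [])               ≡⟨ lastIsOne-o (last s ss) ⟩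
      lastIsOne (last s ss ∷ [])                   ≡⟨ lastIsOne-last s ss ⟨
      lastIsOne (s ∷ ss)                           ∎
    where open ≡-Reasoning

  lastIsOne-o-≡ : ∀ s ss {bs} → o (node (s ∷ ss)) ≡ node bs → lastIsOne (s ∷ ss) ≡ lastIsOne bs
  lastIsOne-o-≡ s ss equal = trans (sym (lastIsOne-sumω 𝟘 s ss)) (cong (lastIsOne ∘ summands) equal)

  kind-succ⇒ : ∀ ts → kind (node ts) ≡ isSucc → lastIsOne ts ≡ true
  kind-succ⇒ (s ∷ ss) ks with lastIsOne (s ∷ ss)
  ... | true = refl

  kind-limit⇒ : ∀ ts → kind (node ts) ≡ isLimit → lastIsOne ts ≡ false
  kind-limit⇒ (s ∷ ss) kl with lastIsOne (s ∷ ss)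
  ... | false = refl

  kind-o-≡ : ∀ s ss {bs} → o (node (s ∷ ss)) ≡ node bs → kind (node (s ∷ ss)) ≡ kind (node bs)
  kind-o-≡ s ss {[]}    equal = ⊥-elim (summands-o≢[] 𝟘 s ss (cong summands equal))
  kind-o-≡ s ss {_ ∷ _} equal = cong (λ b → if b then isSucc else isLimit) (lastIsOne-o-≡ s ss equal)

  filter-notBelow-𝟘 : ∀ as → filterᵇ (notBelow 𝟘) as ≡ as
  filter-notBelow-𝟘 []             = refl
  filter-notBelow-𝟘 (node xs ∷ as) =
    trans (filter-notBelow (node xs) 𝟘 as (¬<ᴸ[] xs)) (cong (node xs ∷_) (filter-notBelow-𝟘 as))

  fsL-∷ʳ : ∀ P y m → fsL (P ++ y ∷ []) m ≡ P ++ fsLast y m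
  fsL-∷ʳ []          y m = refl
  fsL-∷ʳ (p ∷ [])    y m = refl
  fsL-∷ʳ (p ∷ q ∷ P) y m = cong (p ∷_) (fsL-∷ʳ (q ∷ P) y m)

  -- For a successor the fundamental sequence only drops the final ω⁰, whatever the argument.
  sumω-fsL-succ : ∀ A ts n m → lastIsOne ts ≡ true → sumω A (oL (fsL ts n)) ≡ sumω A (oL ts) [ m ]
  sumω-fsL-succ (node as) (node [] ∷ [])      n m _  = cong node (sym (begin
      fsL (filterᵇ (notBelow 𝟘) as ++ 𝟘 ∷ []) m  ≡⟨ fsL-∷ʳ (filterᵇ (notBelow 𝟘) as) 𝟘 m ⟩
      filterᵇ (notBelow 𝟘) as ++ []             ≡⟨ ++-identityʳ _ ⟩
      filterᵇ (notBelow 𝟘) as                   ≡⟨ filter-notBelow-𝟘 as ⟩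
      as                                        ∎))
    where open ≡-Reasoning
  sumω-fsL-succ A         (node (_ ∷ _) ∷ []) n m ()
  sumω-fsL-succ A         (x ∷ u ∷ us)        n m li =
    sumω-fsL-succ (A ⊕ ω^ o x) (u ∷ us) n m (trans (sym (lastIsOne-∷ x u us)) li)

  o-[]-succ : ∀ ts n m → lastIsOne ts ≡ true → o (node ts [ n ]) ≡ o (node ts) [ m ]
  o-[]-succ = sumω-fsL-succ 𝟘

  fsLast-succ : ∀ T m → lastIsOne (summands T) ≡ true → fsLast T m ≡ replicate m (T [ m ])
  fsLast-succ (node (s ∷ ss)) m li rewrite li = refl

  fsLast-limit : ∀ T m → summands T ≢ [] → lastIsOne (summands T) ≡ false → fsLast T m ≡ T [ m ] ∷ []
  fsLast-limit (node [])       m ne li = ⊥-elim (ne refl)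
  fsLast-limit (node (s ∷ ss)) m ne li rewrite li = refl

  oL-replicate : ∀ n y → oL (replicate n y) ≡ replicate n (o y)
  oL-replicate zero    y = refl
  oL-replicate (suc n) y = cong (o y ∷_) (oL-replicate n y)

  -- Norms

  NL-++ : ∀ xs ys → NL (xs ++ ys) ≡ NL xs + NL ys
  NL-++ []       ys = refl
  NL-++ (x ∷ xs) ys rewrite NL-++ xs ys = sym (+-assoc (suc (N x)) (NL xs) (NL ys))

  NL-replicate : ∀ n x → NL (replicate n x) ≡ n * suc (N x)
  NL-replicate zero    x = refl
  NL-replicate (suc n) x = cong (suc (N x) +_) (NL-replicate n x)

  NL-filterᵇ-≤ : ∀ (p : Tree → Bool) xs → NL (filterᵇ p xs) ≤ NL xs
  NL-filterᵇ-≤ p []       = z≤n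
  NL-filterᵇ-≤ p (x ∷ xs) with p x
  ... | true  = +-monoʳ-≤ (suc (N x)) (NL-filterᵇ-≤ p xs)
  ... | false = ≤-trans (NL-filterᵇ-≤ p xs) (m≤n+m (NL xs) (suc (N x)))

  N-⊕ω-≤ : ∀ A x → N (A ⊕ ω^ x) ≤ N A + suc (N x)
  N-⊕ω-≤ (node as) x = begin
      NL (filterᵇ (notBelow x) as ++ x ∷ [])
    ≡⟨ NL-++ (filterᵇ (notBelow x) as) (x ∷ []) ⟩
      NL (filterᵇ (notBelow x) as) + (suc (N x) + 0)
    ≡⟨ cong (NL (filterᵇ (notBelow x) as) +_) (+-identityʳ (suc (N x))) ⟩
      NL (filterᵇ (notBelow x) as) + suc (N x)
    ≤⟨ +-monoˡ-≤ (suc (N x)) (NL-filterᵇ-≤ (notBelow x) as) ⟩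
      NL as + suc (N x) ∎
    where open ≤-Reasoning

  N-sumω-≤ : ∀ A xs → N (sumω A xs) ≤ N A + NL xs
  N-sumω-≤ A []       = ≤-reflexive (sym (+-identityʳ (N A)))
  N-sumω-≤ A (x ∷ xs) = begin
      N (sumω (A ⊕ ω^ x) xs)    ≤⟨ N-sumω-≤ (A ⊕ ω^ x) xs ⟩
      N (A ⊕ ω^ x) + NL xs      ≤⟨ +-monoˡ-≤ (NL xs) (N-⊕ω-≤ A x) ⟩
      N A + suc (N x) + NL xs   ≡⟨ +-assoc (N A) (suc (N x)) (NL xs) ⟩
      N A + NL (x ∷ xs)         ∎
    where open ≤-Reasoning

  mutual
    N-o-≤ : ∀ t → N (o t) ≤ N t
    N-o-≤ (node ts) = ≤-trans (N-sumω-≤ 𝟘 (oL ts)) (NL-oL-≤ ts)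

    NL-oL-≤ : ∀ ts → NL (oL ts) ≤ NL ts
    NL-oL-≤ []       = z≤n
    NL-oL-≤ (t ∷ ts) = +-mono-≤ (s≤s (N-o-≤ t)) (NL-oL-≤ ts)

  NL-fsL-succ : ∀ bs m → lastIsOne bs ≡ true → NL bs ≡ NL (fsL bs m) + 1
  NL-fsL-succ (node [] ∷ []) m _  = refl
  NL-fsL-succ (x ∷ u ∷ us)   m li = begin
      suc (N x) + NL (u ∷ us)                   ≡⟨ cong (suc (N x) +_) (NL-fsL-succ (u ∷ us) m li′) ⟩
      suc (N x) + (NL (fsL (u ∷ us) m) + 1)     ≡⟨ +-assoc (suc (N x)) _ 1 ⟨
      suc (N x) + NL (fsL (u ∷ us) m) + 1       ∎
    where
      open ≡-Reasoning
      li′ = trans (sym (lastIsOne-∷ x u us)) li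

  NL-fsL-limit : ∀ b bs m → lastIsOne (b ∷ bs) ≡ false → 1 ≤ m → NL (b ∷ bs) + m ≤ NL (fsL (b ∷ bs) m) + 2
  NL-fsL-limit (node (s ∷ ss)) [] m _ 1≤m with lastIsOne (s ∷ ss) in li
  ... | true  = begin
      suc (NL (s ∷ ss) + 0) + m  ≡⟨ cong (λ k → suc (k + 0) + m) (NL-fsL-succ (s ∷ ss) m li) ⟩
      suc (a + 1 + 0) + m        ≤⟨ arith a m 1≤m ⟩
      m * suc a + 2              ≡⟨ cong (_+ 2) (NL-replicate m (node (fsL (s ∷ ss) m))) ⟨
      NL (replicate m (node (fsL (s ∷ ss) m))) + 2 ∎
    where
      open ≤-Reasoning
      a = NL (fsL (s ∷ ss) m)
      arith : ∀ a m → 1 ≤ m → suc (a + 1 + 0) + m ≤ m * suc a + 2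
      arith a (suc k) _ = begin
          suc (a + 1 + 0) + suc k  ≡⟨ shift a k ⟩
          a + suc k + 2            ≤⟨ +-monoˡ-≤ 2 (+-monoˡ-≤ (suc k) (m≤m+n a (k * a))) ⟩
          a + k * a + suc k + 2    ≡⟨ expand a k ⟨
          suc k * suc a + 2        ∎
        where
          shift : ∀ a k → suc (a + 1 + 0) + suc k ≡ a + suc k + 2
          shift = solve-∀
          expand : ∀ a k → suc k * suc a + 2 ≡ a + k * a + suc k + 2
          expand = solve-∀
  ... | false = begin
      suc (NL (s ∷ ss) + 0) + m              ≡⟨ cong (λ k → suc k + m) (+-identityʳ _) ⟩
      suc (NL (s ∷ ss) + m)                  ≤⟨ s≤s (NL-fsL-limit s ss m li 1≤m) ⟩
      suc (NL (fsL (s ∷ ss) m) + 2)          ≡⟨ cong (λ k → suc k + 2) (+-identityʳ _) ⟨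
      suc (NL (fsL (s ∷ ss) m) + 0) + 2      ∎
    where open ≤-Reasoning
  NL-fsL-limit x (u ∷ us) m li 1≤m = begin
      suc (N x) + NL (u ∷ us) + m               ≡⟨ +-assoc (suc (N x)) _ m ⟩
      suc (N x) + (NL (u ∷ us) + m)             ≤⟨ +-monoʳ-≤ (suc (N x)) (NL-fsL-limit u us m li′ 1≤m) ⟩
      suc (N x) + (NL (fsL (u ∷ us) m) + 2)     ≡⟨ +-assoc (suc (N x)) _ 2 ⟨
      suc (N x) + NL (fsL (u ∷ us) m) + 2       ∎
    where
      open ≤-Reasoning
      li′ = trans (sym (lastIsOne-∷ x u us)) li

  -- The Bachmann property

  <ᴸ-succ⇒≤ᴸ-fsL : ∀ as bs m → lastIsOne bs ≡ true → as <ᴸ bs → cmpL as (fsL bs m) ≢ gt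
  <ᴸ-succ⇒≤ᴸ-fsL []       (node [] ∷ [])  m _  _     = λ ()
  <ᴸ-succ⇒≤ᴸ-fsL (a ∷ as) (node [] ∷ [])  m _  as<bs with <ᴸ-∷-inv a as 𝟘 [] as<bs
  ... | inj₁ a<𝟘           = ⊥-elim (¬<ᴼ𝟘 a a<𝟘)
  ... | inj₂ (_ , as<[])   = ⊥-elim (¬<ᴸ[] as as<[])
  <ᴸ-succ⇒≤ᴸ-fsL []       (b ∷ u ∷ us)    m _  _     = λ ()
  <ᴸ-succ⇒≤ᴸ-fsL (a ∷ as) (b ∷ u ∷ us)    m li as<bs with <ᴸ-∷-inv a as b (u ∷ us) as<bs
  ... | inj₁ a<b rewrite a<b = λ ()
  ... | inj₂ (refl , as<us) rewrite cmp-refl a =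
    <ᴸ-succ⇒≤ᴸ-fsL as (u ∷ us) m (trans (sym (lastIsOne-∷ a u us)) li) as<us

  <ᴼ-succ⇒≤ᴼ-[] : ∀ α bs m → lastIsOne bs ≡ true → α <ᴼ node bs → α ≤ᴼ (node bs [ m ])
  <ᴼ-succ⇒≤ᴼ-[] (node as) = <ᴸ-succ⇒≤ᴸ-fsL as

  NL-replicate-< : ∀ m c as → All (_≤ᴼ c) as → replicate m c <ᴸ as → m * suc (N c) < NL as
  NL-replicate-< zero    c (a ∷ as) _            _    = s≤s z≤n
  NL-replicate-< (suc k) c (a ∷ as) (a≤c ∷ as≤c) c<as with <ᴸ-∷-inv c _ a as c<as
  ... | inj₁ c<a          = ⊥-elim (≤ᴼ⇒≯ᴼ a c a≤c c<a)
  ... | inj₂ (refl , c<as′) = +-monoʳ-< (suc (N c)) (NL-replicate-< k c as as≤c c<as′)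

  CNF-head-≤ᴼ⇒All : ∀ {a as} c → CNFList (a ∷ as) → a ≤ᴼ c → All (_≤ᴼ c) (a ∷ as)
  CNF-head-≤ᴼ⇒All {a} c cas a≤c = a≤c ∷ All.map (λ {d} d≤a → ≤ᴼ-trans d a c d≤a a≤c) (CNF-descending cas)

  NL-pos : ∀ as → [] <ᴸ as → 0 < NL as
  NL-pos (_ ∷ _) _ = s≤s z≤n

  bachmann : ∀ bs as m → lastIsOne bs ≡ false → CNFList as → as <ᴸ bs → fsL bs m <ᴸ as →
             NL (fsL bs m) < NL as
  bachmann []                   as       m _  _   as<[] _ = ⊥-elim (¬<ᴸ[] as as<[])
  bachmann (node (s ∷ ss) ∷ []) []       m _  _   _ bm<[] = ⊥-elim (¬<ᴸ[] (fsL (node (s ∷ ss) ∷ []) m) bm<[])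
  bachmann (node (s ∷ ss) ∷ []) (node xs ∷ as) m _ cas as<bs bm<as
    with <ᴸ-∷-inv (node xs) as (node (s ∷ ss)) [] as<bs
  ... | inj₂ (_ , as<[]) = ⊥-elim (¬<ᴸ[] as as<[])
  ... | inj₁ a<e with lastIsOne (s ∷ ss) in li
  ...   | true  = subst (_< NL (node xs ∷ as)) (sym (NL-replicate m y))
                    (NL-replicate-< m y (node xs ∷ as) (CNF-head-≤ᴼ⇒All y cas a≤y) bm<as)
    where
      y   = node (fsL (s ∷ ss) m)
      a≤y = <ᴼ-succ⇒≤ᴼ-[] (node xs) (s ∷ ss) m li a<e
  ...   | false with <ᴸ-∷-inv (node (fsL (s ∷ ss) m)) [] (node xs) as bm<as
  ...     | inj₁ y<a = +-mono-≤ (s≤s (bachmann (s ∷ ss) xs m li (CNF-summands (CNF-head cas)) a<e y<a)) z≤n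
  ...     | inj₂ (refl , []<as) = +-monoʳ-< (suc (N (node xs))) (NL-pos as []<as)
  bachmann (b ∷ u ∷ us)         []       m _  _   _ bm<[] = ⊥-elim (¬<ᴸ[] (fsL (b ∷ u ∷ us) m) bm<[])
  bachmann (b ∷ u ∷ us)         (a ∷ as) m li cas as<bs bm<as
    with <ᴸ-∷-inv a as b (u ∷ us) as<bs | <ᴸ-∷-inv b (fsL (u ∷ us) m) a as bm<as
  ... | inj₁ a<b           | inj₁ b<a          = ⊥-elim (<ᴼ-irrefl a (<ᴼ-trans a b a a<b b<a))
  ... | inj₁ a<b           | inj₂ (refl , _)   = ⊥-elim (<ᴼ-irrefl a a<b)
  ... | inj₂ (refl , _)    | inj₁ a<a          = ⊥-elim (<ᴼ-irrefl a a<a)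
  ... | inj₂ (refl , as<us) | inj₂ (_ , bm<as′) = +-monoʳ-< (suc (N a))
          (bachmann (u ∷ us) as m (trans (sym (lastIsOne-∷ a u us)) li) (CNF-tail cas) as<us bm<as′)

  bachmann-≤ᴼ : ∀ α bs m → lastIsOne bs ≡ false → CNF α → α <ᴼ node bs →
                N α ≤ N (node bs [ m ]) → α ≤ᴼ (node bs [ m ])
  bachmann-≤ᴼ (node as) bs m li (cnf cas) α<β Nα≤Nβm α>βm =
    <⇒≱ (bachmann bs as m li cas α<β (>ᴸ-flip as (fsL bs m) α>βm)) Nα≤Nβm

  -- The correction function

  anyLater-constant : ∀ t {y} L → All (_≡ y) L → anyLater t L ≡ true → (t <ᵀᵇ y) ≡ true
  anyLater-constant t (x ∷ L) (x≡y ∷ L≡y) later with t <ᵀᵇ x in t<x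
  ... | true  = subst (λ z → (t <ᵀᵇ z) ≡ true) x≡y t<x
  ... | false = anyLater-constant t L L≡y later

  anyLater-self : ∀ y L → All (_≡ y) L → anyLater y L ≡ false
  anyLater-self y []      []          = refl
  anyLater-self y (_ ∷ L) (refl ∷ L≡y) with o y <ᵇ o y in y<y
  ... | true  = ⊥-elim (<ᴼ-irrefl (o y) (<ᵇ⇒<ᴼ (o y) (o y) y<y))
  ... | false = anyLater-self y L L≡y

  crSum-constant : ∀ y L → All (_≡ y) L → crSum L ≡ 0
  crSum-constant y []      []           = refl
  crSum-constant y (_ ∷ L) (refl ∷ L≡y) rewrite anyLater-self y L L≡y = crSum-constant y L L≡y

  crMax-constant : ∀ y L → All (_≡ y) L → crMax L ≤ Cr y
  crMax-constant y []      []           = z≤n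
  crMax-constant y (_ ∷ L) (refl ∷ L≡y) = ⊔-lub ≤-refl (crMax-constant y L L≡y)

  anyLater-∷ : ∀ t u us → o t <ᴼ o u → anyLater t (u ∷ us) ≡ true
  anyLater-∷ t u us t<u rewrite <ᴼ⇒<ᵇ (o t) (o u) t<u = refl

  anyLater-∷-mono : ∀ t x R R′ → (anyLater t R ≡ true → anyLater t R′ ≡ true) →
                    anyLater t (x ∷ R) ≡ true → anyLater t (x ∷ R′) ≡ true
  anyLater-∷-mono t x R R′ R⇒R′ later with t <ᵀᵇ x
  ... | true  = refl
  ... | false = R⇒R′ later

  anyLater-fsL : ∀ t ys n → anyLater t (fsL ys n) ≡ true → anyLater t ys ≡ true
  anyLater-fsL t (node [] ∷ [])       n ()
  anyLater-fsL t (node (s ∷ ss) ∷ []) n later =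
    anyLater-∷ t (node (s ∷ ss)) [] (<ᴼ-trans (o t) _ _ t<y (o-[]-<ᴼ s ss n))
    where t<y = <ᵇ⇒<ᴼ (o t) _ (anyLater-constant t _ (fsLast-constant s ss n) later)
  anyLater-fsL t (x ∷ u ∷ us)         n =
    anyLater-∷-mono t x (fsL (u ∷ us) n) (u ∷ us) (anyLater-fsL t (u ∷ us) n)

  if-then-0-mono-≤ : ∀ (a b : Bool) {u v} → (a ≡ true → b ≡ true) → u ≤ v →
                     (if a then u else 0) ≤ (if b then v else 0)
  if-then-0-mono-≤ false b    a⇒b u≤v = z≤n
  if-then-0-mono-≤ true  b    a⇒b u≤v rewrite a⇒b refl = u≤v

  crSum-fsL-≤ : ∀ ys n → crSum (fsL ys n) ≤ crSum ys
  crSum-fsL-≤ []                   n = z≤n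
  crSum-fsL-≤ (node [] ∷ [])       n = z≤n
  crSum-fsL-≤ (node (s ∷ ss) ∷ []) n = ≤-reflexive (crSum-constant _ _ (fsLast-constant s ss n))
  crSum-fsL-≤ (x ∷ u ∷ us)         n =
    +-mono-≤ (if-then-0-mono-≤ (anyLater x (fsL (u ∷ us) n)) (anyLater x (u ∷ us)) (anyLater-fsL x (u ∷ us) n) ≤-refl)
             (crSum-fsL-≤ (u ∷ us) n)

  mutual
    Cr-[]-≤ : ∀ t n → Cr (t [ n ]) ≤ Cr t
    Cr-[]-≤ (node ts) n = +-mono-≤ (crSum-fsL-≤ ts n) (crMax-fsL-≤ ts n)

    crMax-fsL-≤ : ∀ ys n → crMax (fsL ys n) ≤ crMax ys
    crMax-fsL-≤ []                   n = z≤n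
    crMax-fsL-≤ (node [] ∷ [])       n = z≤n
    crMax-fsL-≤ (node (s ∷ ss) ∷ []) n =
      ≤-trans (crMax-constant _ _ (fsLast-constant s ss n))
              (≤-trans (Cr-[]-≤ (node (s ∷ ss)) n) (m≤m⊔n _ 0))
    crMax-fsL-≤ (x ∷ u ∷ us)         n = ⊔-monoʳ-≤ (Cr x) (crMax-fsL-≤ (u ∷ us) n)

  normBelowLast : Tree → List Tree → ℕ
  normBelowLast x []       = 0
  normBelowLast x (u ∷ us) = (if x <ᵀᵇ last u us then suc (N x) else 0) + normBelowLast u us

  anyLater-last : ∀ x u us → (x <ᵀᵇ last u us) ≡ true → anyLater x (u ∷ us) ≡ true
  anyLater-last x u []       x<l rewrite x<l = refl
  anyLater-last x u (v ∷ vs) x<l with x <ᵀᵇ u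
  ... | true  = refl
  ... | false = anyLater-last x v vs x<l

  normBelowLast+Cr≤Cr : ∀ s ss → normBelowLast s ss + Cr (last s ss) ≤ Cr (node (s ∷ ss))
  normBelowLast+Cr≤Cr s []       = ≤-trans (m≤m⊔n (Cr s) 0) (m≤n+m _ (0 + 0))
  normBelowLast+Cr≤Cr x (u ∷ us) = begin
      below + normBelowLast u us + Cr (last u us)          ≡⟨ +-assoc below _ _ ⟩
      below + (normBelowLast u us + Cr (last u us))        ≤⟨ +-mono-≤ below≤later (normBelowLast+Cr≤Cr u us) ⟩
      later + (crSum (u ∷ us) + crMax (u ∷ us))            ≤⟨ +-monoʳ-≤ later (+-monoʳ-≤ (crSum (u ∷ us)) (m≤n⊔m (Cr x) _)) ⟩
      later + (crSum (u ∷ us) + (Cr x ⊔ crMax (u ∷ us)))   ≡⟨ +-assoc later _ _ ⟨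
      later + crSum (u ∷ us) + (Cr x ⊔ crMax (u ∷ us))     ∎
    where
      open ≤-Reasoning
      below = if x <ᵀᵇ last u us then suc (N x) else 0
      later = if anyLater x (u ∷ us) then N (ω^ x) else 0
      below≤later : below ≤ later
      below≤later = if-then-0-mono-≤ (x <ᵀᵇ last u us) (anyLater x (u ∷ us))
                      (anyLater-last x u us) (≤-reflexive (sym (+-identityʳ (suc (N x)))))

  normBelow : Tree → List Tree → ℕ
  normBelow b as = NL (filterᵇ (_<ᵇ b) as)

  NL-filterᵇ-split : ∀ (p : Tree → Bool) xs → NL xs ≡ NL (filterᵇ (not ∘ p) xs) + NL (filterᵇ p xs)
  NL-filterᵇ-split p []       = refl
  NL-filterᵇ-split p (x ∷ xs) with p x
  ... | true  = trans (cong (suc (N x) +_) (NL-filterᵇ-split p xs)) (x∙yz≈y∙xz (suc (N x)) _ _)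
  ... | false = trans (cong (suc (N x) +_) (NL-filterᵇ-split p xs)) (sym (+-assoc (suc (N x)) _ _))

  NL-filterᵇ-filterᵇ-≤ : ∀ (p q : Tree → Bool) xs → NL (filterᵇ q (filterᵇ p xs)) ≤ NL (filterᵇ q xs)
  NL-filterᵇ-filterᵇ-≤ p q []       = z≤n
  NL-filterᵇ-filterᵇ-≤ p q (x ∷ xs) with p x
  ... | true  with q x
  ...   | true  = +-monoʳ-≤ (suc (N x)) (NL-filterᵇ-filterᵇ-≤ p q xs)
  ...   | false = NL-filterᵇ-filterᵇ-≤ p q xs
  NL-filterᵇ-filterᵇ-≤ p q (x ∷ xs) | false with q x
  ...   | true  = ≤-trans (NL-filterᵇ-filterᵇ-≤ p q xs) (m≤n+m _ (suc (N x)))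
  ...   | false = NL-filterᵇ-filterᵇ-≤ p q xs

  normBelow-⊕ω : ∀ A x b → normBelow b (summands (A ⊕ ω^ x)) ≤ normBelow b (summands A) + (if x <ᵇ b then suc (N x) else 0)
  normBelow-⊕ω (node as) x b = begin
      NL (filterᵇ (_<ᵇ b) (kept ++ x ∷ []))
    ≡⟨ cong NL (filter-++ (T? ∘ (_<ᵇ b)) kept (x ∷ [])) ⟩
      NL (filterᵇ (_<ᵇ b) kept ++ filterᵇ (_<ᵇ b) (x ∷ []))
    ≡⟨ NL-++ (filterᵇ (_<ᵇ b) kept) _ ⟩
      NL (filterᵇ (_<ᵇ b) kept) + NL (filterᵇ (_<ᵇ b) (x ∷ []))
    ≤⟨ +-mono-≤ (NL-filterᵇ-filterᵇ-≤ (notBelow x) (_<ᵇ b) as) singleton ⟩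
      normBelow b as + (if x <ᵇ b then suc (N x) else 0) ∎
    where
      open ≤-Reasoning
      kept = filterᵇ (notBelow x) as
      singleton : NL (filterᵇ (_<ᵇ b) (x ∷ [])) ≤ (if x <ᵇ b then suc (N x) else 0)
      singleton with x <ᵇ b
      ... | true  = ≤-reflexive (+-identityʳ (suc (N x)))
      ... | false = z≤n

  *-suc-+-mono-≤ : ∀ n c m t → n + c ≤ m → n * suc t + c ≤ m * suc t
  *-suc-+-mono-≤ n c m t n+c≤m = begin
      n * suc t + c      ≡⟨ cong (_+ c) (*-suc n t) ⟩
      n + n * t + c      ≡⟨ xy∙z≈xz∙y n (n * t) c ⟩
      n + c + n * t      ≤⟨ +-mono-≤ n+c≤m (*-monoˡ-≤ t (m+n≤o⇒m≤o n n+c≤m)) ⟩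
      m + m * t          ≡⟨ *-suc m t ⟨
      m * suc t          ∎
    where open ≤-Reasoning

  -- Summands of A below the last summand vanish from o t but may survive in o(t[n]);
  -- their norm is charged to the hypothesis and handed to the last exponent as the slack k.
  mutual
    N-sumω-fsL-limit : ∀ s ss A n m k → lastIsOne (s ∷ ss) ≡ false →
                       n + k + normBelow (o (last s ss)) (summands A) + normBelowLast s ss + Cr (last s ss) ≤ m →
                       N (sumω A (oL (fsL (s ∷ ss) n))) + k ≤ N (sumω A (oL (s ∷ ss)) [ m ])
    N-sumω-fsL-limit (node (r ∷ rs)) [] (node as) n m k _ bound = begin
        N (sumω (node as) (oL L)) + k             ≤⟨ +-monoˡ-≤ k (N-sumω-≤ (node as) (oL L)) ⟩
        NL as + NL (oL L) + k                     ≡⟨ cong (λ z → z + NL (oL L) + k) (NL-filterᵇ-split (_<ᵇ oe) as) ⟩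
        NL kept + swallowed + NL (oL L) + k       ≡⟨ regroup (NL kept) swallowed (NL (oL L)) k ⟩
        NL kept + (NL (oL L) + (k + swallowed))   ≤⟨ +-monoʳ-≤ (NL kept) (NL-oL-fsLast-≤ r rs n m (k + swallowed) bound′) ⟩
        NL kept + NL (fsLast oe m)                ≡⟨ NL-++ kept (fsLast oe m) ⟨
        NL (kept ++ fsLast oe m)                  ≡⟨ cong NL (fsL-∷ʳ kept oe m) ⟨
        NL (fsL (kept ++ oe ∷ []) m)              ∎
      where
        open ≤-Reasoning
        e = node (r ∷ rs)
        oe = o e
        L = fsLast e n
        kept = filterᵇ (notBelow oe) as
        swallowed = normBelow oe as
        regroup : ∀ a b c d → a + b + c + d ≡ a + (c + (d + b))
        regroup = solve-∀
        bound′ : n + (k + swallowed) + Cr e ≤ m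
        bound′ = ≤-trans (≤-reflexive (cong (_+ Cr e) (reassoc n k swallowed))) bound
          where
            reassoc : ∀ a b c → a + (b + c) ≡ a + b + c + 0
            reassoc = solve-∀
    N-sumω-fsL-limit x (u ∷ us) A n m k li bound =
      N-sumω-fsL-limit u us (A ⊕ ω^ o x) n m k (trans (sym (lastIsOne-∷ x u us)) li) bound′
      where
        l = last u us
        charge = if x <ᵀᵇ l then suc (N x) else 0
        before = normBelow (o l) (summands A)
        after≤ : normBelow (o l) (summands (A ⊕ ω^ o x)) ≤ before + charge
        after≤ = ≤-trans (normBelow-⊕ω A (o x) (o l))
                         (+-monoʳ-≤ before (if-then-0-mono-≤ (x <ᵀᵇ l) (x <ᵀᵇ l) (λ c → c) (s≤s (N-o-≤ x))))
        regroup : ∀ a d j e r → a + d + (j + e) + r ≡ a + (d + j) + e + r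
        regroup = solve-∀
        bound′ : n + k + normBelow (o l) (summands (A ⊕ ω^ o x)) + normBelowLast u us + Cr l ≤ m
        bound′ = ≤-trans (+-monoˡ-≤ (Cr l) (+-monoˡ-≤ (normBelowLast u us) (+-monoʳ-≤ (n + k) after≤)))
                   (≤-trans (≤-reflexive (sym (regroup (n + k) before charge (normBelowLast u us) (Cr l)))) bound)

    NL-oL-fsLast-≤ : ∀ r rs n m j → n + j + Cr (node (r ∷ rs)) ≤ m →
                     NL (oL (fsLast (node (r ∷ rs)) n)) + j ≤ NL (fsLast (o (node (r ∷ rs))) m)
    NL-oL-fsLast-≤ r rs n m j bound with lastIsOne (r ∷ rs) in li
    ... | true  = begin
        NL (oL (replicate n y)) + j   ≡⟨ cong (λ z → NL z + j) (oL-replicate n y) ⟩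
        NL (replicate n (o y)) + j    ≡⟨ cong (_+ j) (NL-replicate n (o y)) ⟩
        n * suc (N (o y)) + j         ≤⟨ *-suc-+-mono-≤ n j m (N (o y)) (m+n≤o⇒m≤o (n + j) bound) ⟩
        m * suc (N (o y))             ≡⟨ NL-replicate m (o y) ⟨
        NL (replicate m (o y))        ≡⟨ cong (λ z → NL (replicate m z)) (o-[]-succ (r ∷ rs) n m li) ⟩
        NL (replicate m (oe [ m ]))   ≡⟨ cong NL (fsLast-succ oe m (trans (lastIsOne-sumω 𝟘 r rs) li)) ⟨
        NL (fsLast oe m)              ∎
      where
        open ≤-Reasoning
        y = node (fsL (r ∷ rs) n)
        oe = o (node (r ∷ rs))
    ... | false = begin
        suc (N (o y) + 0) + j         ≡⟨ cong (λ z → suc z + j) (+-identityʳ _) ⟩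
        suc (N (o y) + j)             ≤⟨ s≤s (N-sumω-fsL-limit r rs 𝟘 n m j li bound′) ⟩
        suc (N (oe [ m ]))            ≡⟨ cong suc (+-identityʳ _) ⟨
        NL (oe [ m ] ∷ [])            ≡⟨ cong NL (fsLast-limit oe m (summands-o≢[] 𝟘 r rs) (trans (lastIsOne-sumω 𝟘 r rs) li)) ⟨
        NL (fsLast oe m)              ∎
      where
        open ≤-Reasoning
        y = node (fsL (r ∷ rs) n)
        oe = o (node (r ∷ rs))
        regroup : ∀ a b c → a + 0 + b + c ≡ a + (b + c)
        regroup = solve-∀
        bound′ : n + j + 0 + normBelowLast r rs + Cr (last r rs) ≤ m
        bound′ = ≤-trans (≤-reflexive (regroup (n + j) _ _))
                   (≤-trans (+-monoʳ-≤ (n + j) (normBelowLast+Cr≤Cr r rs)) bound)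

  N-o-[]-limit : ∀ s ss n m → lastIsOne (s ∷ ss) ≡ false → n + Cr (node (s ∷ ss)) ≤ m →
                 N (o (node (s ∷ ss) [ n ])) ≤ N (o (node (s ∷ ss)) [ m ])
  N-o-[]-limit s ss n m li bound =
    ≤-trans (≤-reflexive (sym (+-identityʳ _))) (N-sumω-fsL-limit s ss 𝟘 n m 0 li bound′)
    where
      regroup : ∀ a b c → a + 0 + 0 + b + c ≡ a + (b + c)
      regroup = solve-∀
      bound′ : n + 0 + 0 + normBelowLast s ss + Cr (last s ss) ≤ m
      bound′ = ≤-trans (≤-reflexive (regroup n _ _)) (≤-trans (+-monoʳ-≤ n (normBelowLast+Cr≤Cr s ss)) bound)

  -- The induction along the evaluation of H_β(m)

  record Premises (t : Tree) (n : ℕ) (β : Tree) (m : ℕ) : Set where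
    constructor premises
    field
      value≤      : o t ≤ᴼ β
      norm≤       : n + N (o t) + 2 ≤ m + N β
      correction< : n + Cr t + 2 < m

  open Premises

  n+2≤m : ∀ {t n β m} → Premises t n β m → n + 2 ≤ m
  n+2≤m {t} {n} p = ≤-trans (+-monoˡ-≤ 2 (m≤m+n n (Cr t))) (<⇒≤ (correction< p))

  n+Cr≤m : ∀ {t n β m} → Premises t n β m → n + Cr t ≤ m
  n+Cr≤m {t} {n} p = ≤-trans (m≤m+n (n + Cr t) 2) (<⇒≤ (correction< p))

  correction<-[] : ∀ {t n β m} → Premises t n β m → n + Cr (t [ n ]) + 2 < m
  correction<-[] {t} {n} p = ≤-trans (s≤s (+-monoˡ-≤ 2 (+-monoʳ-≤ n (Cr-[]-≤ t n)))) (correction< p)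

  premises-zero : ∀ {t n m} → Premises t n 𝟘 m → t ≡ 𝟘
  premises-zero {node []}       p = refl
  premises-zero {node (s ∷ ss)} p = ⊥-elim (summands-o≢[] 𝟘 s ss (cong summands (≤ᴼ𝟘⇒≡𝟘 (o (node (s ∷ ss))) (value≤ p))))

  premises-succ-below : ∀ {t n bs m} → lastIsOne bs ≡ true → o t <ᴼ node bs →
                        Premises t n (node bs) m → Premises t n (node bs [ m ]) (suc m)
  premises-succ-below {t} {n} {bs} {m} li below p = premises
    (<ᴼ-succ⇒≤ᴼ-[] (o t) bs m li below)
    (≤-trans (norm≤ p) (≤-reflexive (trans (cong (m +_) (NL-fsL-succ bs m li)) (shift m _))))
    (m<n⇒m<1+n (correction< p))
    where
      shift : ∀ a b → a + (b + 1) ≡ suc a + b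
      shift = solve-∀

  premises-succ-equal : ∀ {s ss n bs m} → lastIsOne (s ∷ ss) ≡ true → o (node (s ∷ ss)) ≡ node bs →
                        Premises (node (s ∷ ss)) n (node bs) m →
                        Premises (node (s ∷ ss) [ n ]) (suc n) (node bs [ m ]) (suc m)
  premises-succ-equal {s} {ss} {n} {bs} {m} li equal p = premises
    (≡⇒≤ᴼ value≡)
    (subst (λ α → suc n + N α + 2 ≤ suc m + N (node bs [ m ])) (sym value≡)
           (≤-trans (≤-reflexive (shift n (N (node bs [ m ])))) (+-monoˡ-≤ (N (node bs [ m ])) (s≤s (n+2≤m p)))))
    (s≤s (correction<-[] p))
    where
      value≡ : o (node (s ∷ ss) [ n ]) ≡ node bs [ m ]
      value≡ = trans (o-[]-succ (s ∷ ss) n m li) (cong (_[ m ]) equal)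
      shift : ∀ a b → suc a + b + 2 ≡ suc (a + 2) + b
      shift = solve-∀

  premises-limit-below : ∀ {t n b bs m} → lastIsOne (b ∷ bs) ≡ false → o t <ᴼ node (b ∷ bs) →
                         Premises t n (node (b ∷ bs)) m → Premises t n (node (b ∷ bs) [ m ]) m
  premises-limit-below {t} {n} {b} {bs} {m} li below p = premises
    (bachmann-≤ᴼ (o t) (b ∷ bs) m li (o-CNF t) below (≤-trans (m≤n+m (N (o t)) n) n+Nα≤X))
    (≤-trans (+-mono-≤ n+Nα≤X 2≤m) (≤-reflexive (+-comm X m)))
    (correction< p)
    where
      X = N (node (b ∷ bs) [ m ])
      2≤m : 2 ≤ m
      2≤m = ≤-trans (m≤n+m 2 n) (n+2≤m p)
      n+Nα≤X : n + N (o t) ≤ X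
      n+Nα≤X = +-cancelʳ-≤ 2 (n + N (o t)) X
                 (≤-trans (norm≤ p) (≤-trans (≤-reflexive (+-comm m _)) (NL-fsL-limit b bs m li (≤-trans (s≤s z≤n) 2≤m))))

  premises-limit-equal : ∀ {s ss n bs m} → lastIsOne (s ∷ ss) ≡ false → o (node (s ∷ ss)) ≡ node bs →
                         Premises (node (s ∷ ss)) n (node bs) m →
                         Premises (node (s ∷ ss) [ n ]) n (node bs [ m ]) m
  premises-limit-equal {s} {ss} {n} {bs} {m} li equal p = premises
    (bachmann-≤ᴼ α bs m (trans (sym (lastIsOne-o-≡ s ss equal)) li) (o-CNF (node (s ∷ ss) [ n ])) α<β Nα≤X)
    (≤-trans (≤-reflexive (xy∙z≈xz∙y n (N α) 2)) (+-mono-≤ (n+2≤m p) Nα≤X))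
    (correction<-[] p)
    where
      α = o (node (s ∷ ss) [ n ])
      X = N (node bs [ m ])
      α<β : α <ᴼ node bs
      α<β = subst (α <ᴼ_) equal (o-[]-<ᴼ s ss n)
      Nα≤X : N α ≤ X
      Nα≤X = subst (λ β → N α ≤ N (β [ m ])) equal (N-o-[]-limit s ss n m li (n+Cr≤m p))

  hardy-≤ : ∀ {β m z} → Hardy β m z → ∀ t n → Premises t n β m → Σ ℕ λ y → Hardy t n y × y ≤ z
  hardy-≤ H-zero t n p rewrite premises-zero p = n , H-zero , m+n≤o⇒m≤o n (n+2≤m p)
  hardy-≤ {node bs} {m} (H-succ ks hd) t n p with ≤ᴼ⇒<ᴼ⊎≡ (o t) (node bs) (value≤ p)
  ... | inj₁ below = hardy-≤ hd t n (premises-succ-below (kind-succ⇒ bs ks) below p)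
  hardy-≤ (H-succ () _) (node []) n p | inj₂ refl
  hardy-≤ {node bs} {m} (H-succ ks hd) (node (s ∷ ss)) n p | inj₂ equal
    with hardy-≤ hd _ (suc n) (premises-succ-equal (trans (lastIsOne-o-≡ s ss equal) (kind-succ⇒ bs ks)) equal p)
  ... | y , h , y≤z = y , H-succ (trans (kind-o-≡ s ss equal) ks) h , y≤z
  hardy-≤ {node (b ∷ bs)} {m} (H-limit kl hd) t n p with ≤ᴼ⇒<ᴼ⊎≡ (o t) (node (b ∷ bs)) (value≤ p)
  ... | inj₁ below = hardy-≤ hd t n (premises-limit-below (kind-limit⇒ (b ∷ bs) kl) below p)
  hardy-≤ (H-limit _ _) (node []) n p | inj₂ ()
  hardy-≤ {node (b ∷ bs)} {m} (H-limit kl hd) (node (s ∷ ss)) n p | inj₂ equal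
    with hardy-≤ hd _ n (premises-limit-equal (trans (lastIsOne-o-≡ s ss equal) (kind-limit⇒ (b ∷ bs) kl)) equal p)
  ... | y , h , y≤z = y , H-limit (trans (kind-o-≡ s ss equal) kl) h , y≤z

  +a-+b≤+c-+d⇒a+d≤c+b : ∀ a b c d → (ℤ.+ a) ℤ.- (ℤ.+ b) ℤ.≤ (ℤ.+ c) ℤ.- (ℤ.+ d) → a + d ≤ c + b
  +a-+b≤+c-+d⇒a+d≤c+b a b c d a-b≤c-d =
    ℤ.drop‿+≤+ (subst₂ ℤ._≤_ (cancel (ℤ.+ a) (ℤ.+ b) (ℤ.+ d)) (swap (ℤ.+ c) (ℤ.+ d) (ℤ.+ b))
                 (ℤ.+-monoˡ-≤ ((ℤ.+ b) ℤ.+ (ℤ.+ d)) a-b≤c-d))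
    where
      cancel : ∀ x y w → (x ℤ.- y) ℤ.+ (y ℤ.+ w) ≡ x ℤ.+ w
      cancel = ℤ.solve-∀
      swap : ∀ x w y → (x ℤ.- w) ℤ.+ (y ℤ.+ w) ≡ x ℤ.+ y
      swap = ℤ.solve-∀

  +a<+c-+d⇒a+d<c : ∀ a c d → ℤ.+ a ℤ.< (ℤ.+ c) ℤ.- (ℤ.+ d) → a + d < c
  +a<+c-+d⇒a+d<c a c d a<c-d =
    ℤ.drop‿+<+ (subst (ℤ.+ (a + d) ℤ.<_) (cancel (ℤ.+ c) (ℤ.+ d)) (ℤ.+-monoˡ-< (ℤ.+ d) a<c-d))
    where
      cancel : ∀ x w → (x ℤ.- w) ℤ.+ w ≡ x
      cancel = ℤ.solve-∀

  premises-ℤ : ∀ t β n m → o t ≤ᴼ β →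
               (ℤ.+ n ℤ.+ ℤ.+ N (o t)) ℤ.- ℤ.+ N β ℤ.≤ ℤ.+ m ℤ.- ℤ.+ 2 →
               (ℤ.+ n ℤ.+ ℤ.+ Cr t) ℤ.< ℤ.+ m ℤ.- ℤ.+ 2 →
               Premises t n β m
  premises-ℤ t β n m value≤ norm correction = premises value≤
    (+a-+b≤+c-+d⇒a+d≤c+b (n + N (o t)) (N β) m 2 norm)
    (+a<+c-+d⇒a+d<c (n + Cr t) m 2 correction)

open import Defs
open import Data.Nat using (ℕ; _≤_)
open import Data.Integer using (+_; _-_; _+_) renaming (_≤_ to _≤ℤ_; _<_ to _<ℤ_)
open import Data.Product using (Σ; _×_)
open Domination using (hardy-≤; premises-ℤ)

theorem10 : (t β : Tree) → CNF β → (n m : ℕ)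
    → o t ≤ᴼ β
    → ((+ n) + (+ N (o t))) - (+ N β) ≤ℤ (+ m) - (+ 2)
    → ((+ n) + (+ Cr t)) <ℤ (+ m) - (+ 2)
    → (z : ℕ) → Hardy β m z
    → Σ ℕ (λ y → Hardy t n y × y ≤ z)
theorem10 t β _ n m value≤ norm correction z hz = hardy-≤ hz t n (premises-ℤ t β n m value≤ norm correction)
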